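{- Let $l\in\mathbb{N}$. There exist an increasing function $c:\mathbb{N}\to\mathbb{N}$ and a strictly increasing sequence $(x_i)_{i=1}^\infty$ of positive integers such that for every $h\in\mathbb{N}$ and all $x,y\in S_h$ with $x\ne y$ we have $x\le c(h)$ and $\gcd(x,y)\in T(l)$, where $S_h=\bigcup_{i=1}^h[x_i,x_i+2l]$.
   Context: $\mathbb{N}=\{1,2,3,\dots\}$, $\mathbb{P}$ is the set of primes, $[a,b]=\{x\in\mathbb{Z}:a\le x\le b\}$. For prime $p$, $r(p,l)=\max\{t\in\mathbb{N}\cup\{0\}: p^t\le 2l+1\}$, and $T(l)=\{\prod_{p\in\mathbb{P}\cap[2,2l+1]}p^{r_p}: 0\le r_p\le r(p,l)\}$. -}

module Defs where

open import Data.Nat using (ℕ; zero; suc; _+_; _*_; _^_; _≤_; _<_)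
open import Data.Nat.Primality using (Prime; prime?)
open import Data.Nat.GCD using (gcd)
open import Data.List using (List; upTo; filter; map)
open import Data.Nat.ListAction using (product)
open import Data.Product using (Σ; ∃; _×_)
open import Relation.Binary.PropositionalEquality using (_≡_)

IsR : ℕ → ℕ → ℕ → Set
IsR p l t = (p ^ t ≤ 2 * l + 1) × (∀ s → p ^ s ≤ 2 * l + 1 → s ≤ t)

primesUpTo : ℕ → List ℕ
primesUpTo l = filter prime? (upTo (2 * l + 2))

InT : ℕ → ℕ → Set
InT l n = Σ (ℕ → ℕ) λ e →
  (∀ p → Prime p → p ≤ 2 * l + 1 → ∀ t → IsR p l t → e p ≤ t)
  × (n ≡ product (map (λ p → p ^ e p) (primesUpTo l)))

InS : ℕ → (ℕ → ℕ) → ℕ → ℕ → Set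
InS l xs h n = ∃ λ i → (1 ≤ i) × (i ≤ h) × (xs i ≤ n) × (n ≤ xs i + 2 * l)

-- The proof has two independent halves.
--  * Every n ∈ [1, 2l+1] lies in T(l): writing n as a product of primes
--    and counting multiplicities gives exponents e_p with n = ∏ p ^ e_p over
--    the primes ≤ 2l+1, and p ^ e_p ∣ n ≤ 2l+1 forces e_p ≤ r(p,l).
--  * For any block length L take x_1 = L! + 1 and x_{i+1} = (x_i + L)! + 1.
--    Two distinct points of the union have gcd at most L + 1: in one block
--    the gcd divides their difference (≤ L); in blocks i < j the gcd g is at
--    most B = x_{j-1} + L, so g ∣ B!, and y - B! ∈ [1, L+1] is a multiple of g.
-- The theorem combines both halves with L = 2l and c(h) = x_h + 2l.
module Submission where

open import Defs
open import Data.Nat using (ℕ; _+_; _*_; _≤_; _<_)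
open import Data.Nat.GCD using (gcd)
open import Data.Product using (Σ; _×_)
open import Relation.Binary.PropositionalEquality using (_≡_)
open import Relation.Nullary using (¬_)

open import Data.Nat.Base using (zero; suc; _^_; _!; _∸_; z≤n; s≤s)
open import Data.Nat.Properties
open import Data.Nat.Divisibility
open import Algebra.Properties.CommutativeSemigroup *-commutativeSemigroup using (x∙yz≈y∙xz)
open import Data.Nat.GCD using (gcd[m,n]∣m; gcd[m,n]∣n)
open import Data.Nat.Primality using (Prime; prime?)
open import Data.Nat.Primality.Factorisation using (factorise; PrimeFactorisation)
open import Data.Nat.ListAction using (product)
open import Data.List using (List; []; _∷_; map)
open import Data.List.Relation.Unary.All as All using (All; []; _∷_)
open import Data.List.Relation.Unary.Any using (here; there)
open import Data.List.Relation.Unary.AllPairs using (_∷_)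
open import Data.List.Relation.Unary.Unique.Propositional using (Unique)
import Data.List.Relation.Unary.Unique.Propositional.Properties as Unique
open import Data.List.Membership.Propositional using (_∈_)
open import Data.List.Membership.Propositional.Properties using (∈-filter⁺; ∈-upTo⁺)
open import Data.Product using (_,_; ∃)
open import Data.Sum using (inj₁; inj₂)
open import Relation.Binary.Definitions using (tri<; tri≈; tri>)
open import Data.Empty using (⊥-elim)
open import Relation.Nullary using (yes; no)
open import Relation.Binary.PropositionalEquality using (refl; sym; trans; cong; subst; module ≡-Reasoning)

divisor-pos : ∀ {d n} → 1 ≤ n → d ∣ n → 1 ≤ d
divisor-pos {zero} 1≤n d∣n = ⊥-elim (<⇒≱ 1≤n (≤-reflexive (0∣⇒≡0 d∣n)))
divisor-pos {suc _} _ _ = s≤s z≤n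

divisor-≤ : ∀ {d n} → 1 ≤ n → d ∣ n → d ≤ n
divisor-≤ {n = suc _} _ d∣n = ∣⇒≤ d∣n

divisor-≤-difference : ∀ {g a b} → a < b → g ∣ a → g ∣ b → g ≤ b ∸ a
divisor-≤-difference {g} {a} {b} a<b g∣a g∣b =
  divisor-≤ (m<n⇒0<n∸m a<b) (∣m+n∣m⇒∣n g∣a+[b∸a] g∣a)
  where
  g∣a+[b∸a] : g ∣ a + (b ∸ a)
  g∣a+[b∸a] = subst (g ∣_) (sym (m+[n∸m]≡n (<⇒≤ a<b))) g∣b

∣n! : ∀ {d n} → 1 ≤ d → d ≤ n → d ∣ n !
∣n! {suc k} _ d≤n = ∣-trans (m∣m*n (k !)) (m≤n⇒m!∣n! d≤n)

n≤n! : ∀ n → n ≤ n !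
n≤n! zero = z≤n
n≤n! (suc n) = ∣⇒≤ {{suc n !≢0}} (∣n! (s≤s z≤n) ≤-refl)

prodPow : (ℕ → ℕ) → List ℕ → ℕ
prodPow e qs = product (map (λ q → q ^ e q) qs)

bump : ℕ → (ℕ → ℕ) → ℕ → ℕ
bump p e q with q ≟ p
... | yes _ = suc (e q)
... | no _ = e q

exponentsOf : List ℕ → ℕ → ℕ
exponentsOf [] = λ _ → 0
exponentsOf (p ∷ fs) = bump p (exponentsOf fs)

prodPow-zero : ∀ qs → prodPow (λ _ → 0) qs ≡ 1
prodPow-zero [] = refl
prodPow-zero (q ∷ qs) = trans (+-identityʳ _) (prodPow-zero qs)

prodPow-bump-∉ : ∀ p e qs → All (λ q → ¬ q ≡ p) qs → prodPow (bump p e) qs ≡ prodPow e qs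
prodPow-bump-∉ p e [] [] = refl
prodPow-bump-∉ p e (q ∷ qs) (q≢p ∷ rest) with q ≟ p
... | yes q≡p = ⊥-elim (q≢p q≡p)
... | no _ = cong (q ^ e q *_) (prodPow-bump-∉ p e qs rest)

prodPow-bump-∈ : ∀ p e qs → Unique qs → p ∈ qs → prodPow (bump p e) qs ≡ p * prodPow e qs
prodPow-bump-∈ p e (q ∷ qs) (q∉qs ∷ _) (here refl) with q ≟ q
... | no q≢q = ⊥-elim (q≢q refl)
... | yes _ = begin
  q * q ^ e q * prodPow (bump q e) qs  ≡⟨ cong (q * q ^ e q *_) (prodPow-bump-∉ q e qs q∉qs′) ⟩
  q * q ^ e q * prodPow e qs           ≡⟨ *-assoc q (q ^ e q) _ ⟩
  q * (q ^ e q * prodPow e qs)         ∎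
  where
  open ≡-Reasoning
  q∉qs′ = All.map (λ p≢q q≡p → p≢q (sym q≡p)) q∉qs
prodPow-bump-∈ p e (q ∷ qs) (q∉qs ∷ unique) (there p∈qs) with q ≟ p
... | yes refl = ⊥-elim (All.lookup q∉qs p∈qs refl)
... | no _ = begin
  q ^ e q * prodPow (bump p e) qs  ≡⟨ cong (q ^ e q *_) (prodPow-bump-∈ p e qs unique p∈qs) ⟩
  q ^ e q * (p * prodPow e qs)     ≡⟨ x∙yz≈y∙xz (q ^ e q) p _ ⟩
  p * (q ^ e q * prodPow e qs)     ∎
  where open ≡-Reasoning

product≡prodPow : ∀ qs fs → Unique qs → All (_∈ qs) fs → product fs ≡ prodPow (exponentsOf fs) qs
product≡prodPow qs [] _ [] = sym (prodPow-zero qs)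
product≡prodPow qs (p ∷ fs) unique (p∈qs ∷ fs⊆qs) = begin
  p * product fs                    ≡⟨ cong (p *_) (product≡prodPow qs fs unique fs⊆qs) ⟩
  p * prodPow (exponentsOf fs) qs   ≡⟨ prodPow-bump-∈ p (exponentsOf fs) qs unique p∈qs ⟨
  prodPow (exponentsOf (p ∷ fs)) qs ∎
  where open ≡-Reasoning

pow-multiplicity-∣ : ∀ fs q → q ^ exponentsOf fs q ∣ product fs
pow-multiplicity-∣ [] q = ∣-refl
pow-multiplicity-∣ (p ∷ fs) q with q ≟ p
... | yes refl = *-monoʳ-∣ q (pow-multiplicity-∣ fs q)
... | no _ = ∣n⇒∣m*n p (pow-multiplicity-∣ fs q)

factors-∣-product : ∀ fs → All (_∣ product fs) fs
factors-∣-product [] = []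
factors-∣-product (p ∷ fs) =
  m∣m*n (product fs) ∷ All.map (∣n⇒∣m*n p) (factors-∣-product fs)

primesUpTo-unique : ∀ l → Unique (primesUpTo l)
primesUpTo-unique l = Unique.filter⁺ prime? (Unique.upTo⁺ (2 * l + 2))

prime-∈-primesUpTo : ∀ l {p} → Prime p → p ≤ 2 * l + 1 → p ∈ primesUpTo l
prime-∈-primesUpTo l {p} p-prime p≤ =
  ∈-filter⁺ prime? (∈-upTo⁺ (subst (p <_) (sym (+-suc (2 * l) 1)) (s≤s p≤))) p-prime

-- Every n ∈ [1, 2l+1] belongs to T(l): take the multiplicities of the prime
-- factorisation of n; each prime power p ^ e_p divides n, so p ^ e_p ≤ 2l+1.
small-∈T : ∀ l n → 1 ≤ n → n ≤ 2 * l + 1 → InT l n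
small-∈T l n@(suc _) 1≤n n≤ = e , e-bounded , trans n≡∏fs (product≡prodPow qs fs unique fs⊆qs)
  where
  open PrimeFactorisation (factorise n) renaming (factors to fs; isFactorisation to n≡∏fs)
  qs = primesUpTo l
  e = exponentsOf fs
  unique = primesUpTo-unique l
  ∣n⇒≤ : ∀ {d} → d ∣ product fs → d ≤ 2 * l + 1
  ∣n⇒≤ d∣ = ≤-trans (divisor-≤ 1≤n (subst (_ ∣_) (sym n≡∏fs) d∣)) n≤
  fs⊆qs : All (_∈ qs) fs
  fs⊆qs = All.zipWith (λ (p-prime , p∣) → prime-∈-primesUpTo l p-prime (∣n⇒≤ p∣))
            (factorsPrime , factors-∣-product fs)
  e-bounded : ∀ p → Prime p → p ≤ 2 * l + 1 → ∀ t → IsR p l t → e p ≤ t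
  e-bounded p _ _ t (_ , maximal) = maximal (e p) (∣n⇒≤ (pow-multiplicity-∣ fs p))

module Blocks (L : ℕ) where

  -- x_0 = 0 is a dummy value; the sequence proper starts at x_1 = L! + 1.
  xs : ℕ → ℕ
  xs zero = 0
  xs (suc i) = suc ((xs i + L) !)

  xs-pos : ∀ i → 1 ≤ i → 1 ≤ xs i
  xs-pos (suc i) _ = s≤s z≤n

  block-before : ∀ i j → i < j → xs i + L < xs j
  block-before i (suc j) (s≤s i≤j) with m≤n⇒m<n∨m≡n i≤j
  ... | inj₂ refl = s≤s (n≤n! (xs i + L))
  ... | inj₁ i<j = <-trans (<-≤-trans (block-before i j i<j) (m≤m+n (xs j) L))
                           (s≤s (n≤n! (xs j + L)))

  xs-strict : ∀ i j → i < j → xs i < xs j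
  xs-strict i j i<j = ≤-<-trans (m≤m+n (xs i) L) (block-before i j i<j)

  xs-mono : ∀ i j → i ≤ j → xs i ≤ xs j
  xs-mono i j i≤j with m≤n⇒m<n∨m≡n i≤j
  ... | inj₁ i<j = <⇒≤ (xs-strict i j i<j)
  ... | inj₂ refl = ≤-refl

  InBlock : ℕ → ℕ → Set
  InBlock i n = (xs i ≤ n) × (n ≤ xs i + L)

  same-block-gcd : ∀ i {g x y} → InBlock i x → InBlock i y → x < y → g ∣ x → g ∣ y → g ≤ L
  same-block-gcd i {g} {x} {y} (xi≤x , _) (_ , y≤) x<y g∣x g∣y = begin
    g                    ≤⟨ divisor-≤-difference x<y g∣x g∣y ⟩
    y ∸ x                ≤⟨ ∸-mono y≤ xi≤x ⟩
    (xs i + L) ∸ xs i    ≡⟨ m+n∸m≡n (xs i) L ⟩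
    L                    ∎
    where open ≤-Reasoning

  -- Common divisors of points of blocks i < j are at most L + 1: they are
  -- at most B = x_{j-1} + L, so divide B!, and y - B! ∈ [1, L+1].
  later-block-gcd : ∀ i j {g x y} → 1 ≤ i → i < j → InBlock i x → InBlock j y →
                    g ∣ x → g ∣ y → g ≤ suc L
  later-block-gcd i (suc j) {g} {x} {y} 1≤i (s≤s i≤j) (xi≤x , x≤) (xj≤y , y≤) g∣x g∣y = begin
    g                    ≤⟨ divisor-≤-difference B!<y g∣B! g∣y ⟩
    y ∸ B !              ≤⟨ ∸-monoˡ-≤ (B !) y≤ ⟩
    suc (B ! + L) ∸ B !  ≡⟨ cong (_∸ B !) (sym (+-suc (B !) L)) ⟩
    (B ! + suc L) ∸ B !  ≡⟨ m+n∸m≡n (B !) (suc L) ⟩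
    suc L                ∎
    where
    open ≤-Reasoning
    B = xs j + L
    -- y lies in block j, which starts at x_j = B! + 1.
    B!<y : B ! < y
    B!<y = xj≤y
    1≤x : 1 ≤ x
    1≤x = ≤-trans (xs-pos i 1≤i) xi≤x
    -- g ≤ x ≤ x_i + L ≤ B.
    g∣B! : g ∣ B !
    g∣B! = ∣n! (divisor-pos 1≤x g∣x)
      (≤-trans (divisor-≤ 1≤x g∣x) (≤-trans x≤ (+-monoˡ-≤ L (xs-mono i j i≤j))))

  InUnion : ℕ → ℕ → Set
  InUnion h n = ∃ λ i → (1 ≤ i) × (i ≤ h) × InBlock i n

  union-bounded : ∀ h {x} → InUnion h x → x ≤ xs h + L
  union-bounded h (i , _ , i≤h , _ , x≤) = ≤-trans x≤ (+-monoˡ-≤ L (xs-mono i h i≤h))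

  union-gcd : ∀ h {g x y} → InUnion h x → InUnion h y → ¬ x ≡ y → g ∣ x → g ∣ y → g ≤ suc L
  union-gcd h {g} {x} {y} (i , 1≤i , _ , x∈) (j , 1≤j , _ , y∈) x≢y g∣x g∣y with <-cmp i j
  ... | tri< i<j _ _ = later-block-gcd i j 1≤i i<j x∈ y∈ g∣x g∣y
  ... | tri> _ _ j<i = later-block-gcd j i 1≤j j<i y∈ x∈ g∣y g∣x
  ... | tri≈ _ refl _ with <-cmp x y
  ...   | tri< x<y _ _ = ≤-trans (same-block-gcd i x∈ y∈ x<y g∣x g∣y) (n≤1+n L)
  ...   | tri≈ _ x≡y _ = ⊥-elim (x≢y x≡y)
  ...   | tri> _ _ y<x = ≤-trans (same-block-gcd i y∈ x∈ y<x g∣y g∣x) (n≤1+n L)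

lemma3p5 : (l : ℕ) → 1 ≤ l →
    Σ (ℕ → ℕ) λ c → Σ (ℕ → ℕ) λ xs →
    (∀ h → 1 ≤ h → 1 ≤ c h)
    × (∀ h h′ → 1 ≤ h → h ≤ h′ → c h ≤ c h′)
    × (∀ i → 1 ≤ i → 1 ≤ xs i)
    × (∀ i j → 1 ≤ i → i < j → xs i < xs j)
    × (∀ h → 1 ≤ h → ∀ x y → InS l xs h x → InS l xs h y → ¬ (x ≡ y) →
    (x ≤ c h) × InT l (gcd x y))
lemma3p5 l _ = c , xs
  , (λ h 1≤h → ≤-trans (xs-pos h 1≤h) (m≤m+n (xs h) L))
  , (λ h h′ _ h≤h′ → +-monoˡ-≤ L (xs-mono h h′ h≤h′))
  , xs-pos
  , (λ i j _ → xs-strict i j)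
  , λ h _ x y x∈ y∈ x≢y → union-bounded h x∈ , gcd-∈T h x∈ y∈ x≢y
  where
  L = 2 * l
  open Blocks L
  c : ℕ → ℕ
  c h = xs h + L
  gcd-∈T : ∀ h {x y} → InUnion h x → InUnion h y → ¬ x ≡ y → InT l (gcd x y)
  gcd-∈T h {x} {y} x∈@(i , 1≤i , _ , xi≤x , _) y∈ x≢y =
    small-∈T l (gcd x y) (divisor-pos 1≤x (gcd[m,n]∣m x y))
      (subst (gcd x y ≤_) (+-comm 1 L) (union-gcd h x∈ y∈ x≢y (gcd[m,n]∣m x y) (gcd[m,n]∣n x y)))
    where
    1≤x : 1 ≤ x
    1≤x = ≤-trans (xs-pos i 1≤i) xi≤x
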